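{- Let $\Omega$ be an integral chain, $f:\Omega\to\Omega$ an order-preserving map and $x\in\Omega$. (1) If $f^{\ell\ell}$ exists, then $f^{\ell\ell}(x)=f(x-1)+1$. (2) If $f^{rr}$ exists, then $f^{rr}(x)=f(x+1)-1$.
   Context: A chain is integral if it is isomorphic to a lexicographic product $J\overrightarrow{\times}\mathbb{Z}$ for some chain $J$; in it every $x$ has an upper cover $x+1$ and a lower cover $x-1$. For an order-preserving map $f$ on a chain, the residual is $f^r(b)=\max\{a:f(a)\le b\}$ and the dual residual is $f^\ell(a)=\min\{b:a\le f(b)\}$, when they exist; $f^{\ell\ell}=(f^\ell)^\ell$ and $f^{rr}=(f^r)^r$. -}

module Defs where

open import Level using (0ℓ)
open import Data.Product using (Σ; ∃; ∃-syntax; _×_; _,_)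
open import Data.Integer as ℤ using (ℤ)
open import Relation.Binary.Core using (Rel)
open import Relation.Binary.Structures using (IsTotalOrder)
open import Relation.Binary.PropositionalEquality using (_≡_; _≢_)
open import Relation.Nullary using (¬_)
open import Function.Bundles using (_⤖_; Bijection)
open import Data.Product.Relation.Binary.Lex.NonStrict using (×-Lex)

record Chain : Set₁ where
  field
    Carrier : Set
    _≤_     : Rel Carrier 0ℓ
    isTotalOrder : IsTotalOrder _≡_ _≤_

  _<_ : Rel Carrier 0ℓ
  x < y = (x ≤ y) × (x ≢ y)

  _⋖_ : Rel Carrier 0ℓ
  x ⋖ y = (x < y) × ¬ (∃[ z ] ((x < z) × (z < y)))

open Chain public

_≤lex_ : (J : Chain) → Rel (Carrier J × ℤ) 0ℓ
_≤lex_ J = ×-Lex _≡_ (_≤_ J) ℤ._≤_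

IsIntegral : Chain → Set₁
IsIntegral Ω = Σ Chain λ J → Σ (Carrier Ω ⤖ (Carrier J × ℤ)) λ φ →
  ∀ x y → (_≤_ Ω x y → (_≤lex_ J) (Bijection.to φ x) (Bijection.to φ y))
        × ((_≤lex_ J) (Bijection.to φ x) (Bijection.to φ y) → _≤_ Ω x y)

OrderPreserving : (Ω : Chain) → (Carrier Ω → Carrier Ω) → Set
OrderPreserving Ω f = ∀ {a b} → _≤_ Ω a b → _≤_ Ω (f a) (f b)

IsResidual : (Ω : Chain) → (f g : Carrier Ω → Carrier Ω) → Set
IsResidual Ω f g = ∀ b → _≤_ Ω (f (g b)) b × (∀ a → _≤_ Ω (f a) b → _≤_ Ω a (g b))

IsDualResidual : (Ω : Chain) → (f g : Carrier Ω → Carrier Ω) → Set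
IsDualResidual Ω f g = ∀ a → _≤_ Ω a (f (g a)) × (∀ b → _≤_ Ω a (f b) → _≤_ Ω (g a) b)

-- Write w = x - 1 and y = f w + 1.  By the two Galois connections, fℓℓ x ≤ y
-- follows from x ≤ fℓ y, i.e. from w < fℓ y, i.e. from fℓ y ≰ w, which holds
-- since fℓ y ≤ w would give y ≤ f w.  Dually y ≤ fℓℓ x follows from f w < fℓℓ x,
-- since fℓℓ x ≤ f w would give x ≤ w.  A strict inequality above a point thus
-- always passes to its upper cover; doing so constructively needs decidable
-- equality, which is all that integrality contributes.  The residual case is the
-- dual residual case in the opposite chain.
module Submission where

open import Defs
open import Data.Product using (_×_; _,_; proj₁; proj₂)
open import Data.Product.Relation.Binary.Lex.NonStrict using (×-Lex)
open import Data.Sum using (inj₁; inj₂; [_,_]′)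
open import Data.Empty using (⊥-elim)
import Data.Integer as ℤ
open import Function.Base using (flip; _∘_)
open import Function.Bundles using (Bijection)
open import Relation.Nullary using (¬_; Dec; yes; no)
open import Relation.Nullary.Decidable using (map′)
open import Relation.Binary.Core using (Rel)
open import Relation.Binary.Definitions using (DecidableEquality)
open import Relation.Binary.Structures using (IsTotalOrder)
open import Relation.Binary.PropositionalEquality using (_≡_; sym; cong; cong₂)
import Relation.Binary.Construct.NonStrictToStrict as NonStrictToStrict
import Relation.Binary.Construct.Flip.EqAndOrd as Flip

×-Lex-≟ : ∀ {A B : Set} {ℓ₁ ℓ₂} (_≤₁_ : Rel A ℓ₁) (_≤₂_ : Rel B ℓ₂) → DecidableEquality B →
          ∀ {p q} → ×-Lex _≡_ _≤₁_ _≤₂_ p q → Dec (p ≡ q)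
×-Lex-≟ _ _ _≟₂_ (inj₁ (_ , a≢b)) = no (a≢b ∘ cong proj₁)
×-Lex-≟ _ _ _≟₂_ {_ , m} {_ , n} (inj₂ (a≡b , _)) = map′ (cong₂ _,_ a≡b) (cong proj₂) (m ≟₂ n)

integral⇒decEq : ∀ Ω → IsIntegral Ω → DecidableEquality (Carrier Ω)
integral⇒decEq Ω (J , φ , iso) a b =
  [ decide , map′ sym sym ∘ decide ]′ (IsTotalOrder.total (isTotalOrder Ω) a b)
  where
  open Bijection φ using (to; injective)

  decide : ∀ {a b} → _≤_ Ω a b → Dec (a ≡ b)
  decide {a} {b} a≤b =
    map′ injective (cong to) (×-Lex-≟ (_≤_ J) ℤ._≤_ ℤ._≟_ (proj₁ (iso a b) a≤b))

_ᵒᵖ : Chain → Chain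
Ω ᵒᵖ = record
  { Carrier      = Carrier Ω
  ; _≤_          = flip (_≤_ Ω)
  ; isTotalOrder = Flip.isTotalOrder (isTotalOrder Ω)
  }

⋖⇒⋖ᵒᵖ : ∀ Ω {x y} → _⋖_ Ω x y → _⋖_ (Ω ᵒᵖ) y x
⋖⇒⋖ᵒᵖ Ω ((x≤y , x≢y) , nothing-between) =
  (x≤y , x≢y ∘ sym) ,
  λ { (z , (z≤y , y≢z) , (x≤z , z≢x)) →
        nothing-between (z , (x≤z , z≢x ∘ sym) , (z≤y , y≢z ∘ sym)) }

module _ (Ω : Chain) (_≟_ : DecidableEquality (Carrier Ω)) where
  open Chain Ω using ()
    renaming (_≤_ to _≤Ω_; _<_ to _<Ω_; _⋖_ to _⋖Ω_; isTotalOrder to ≤Ω-isTotalOrder)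
  open IsTotalOrder ≤Ω-isTotalOrder using (total; antisym; reflexive) renaming (trans to ≤-trans)

  ≰⇒> : ∀ {a b} → ¬ (a ≤Ω b) → b <Ω a
  ≰⇒> = NonStrictToStrict.≰⇒> _≡_ _≤Ω_ sym reflexive total

  ⋖⇒≱ : ∀ {a b} → a ⋖Ω b → ¬ (b ≤Ω a)
  ⋖⇒≱ = NonStrictToStrict.<⇒≱ _≡_ _≤Ω_ antisym ∘ proj₁

  ⋖∧<⇒≤ : ∀ {w x z} → w ⋖Ω x → w <Ω z → x ≤Ω z
  ⋖∧<⇒≤ {x = x} {z} (_ , nothing-between) w<z with total x z
  ... | inj₁ x≤z = x≤z
  ... | inj₂ z≤x with z ≟ x
  ...   | yes z≡x = reflexive (sym z≡x)
  ...   | no  z≢x = ⊥-elim (nothing-between (z , w<z , z≤x , z≢x))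

  dualResidual²-⋖ : ∀ {f fℓ fℓℓ} → OrderPreserving Ω f →
                    IsDualResidual Ω f fℓ → IsDualResidual Ω fℓ fℓℓ →
                    ∀ {w x y} → w ⋖Ω x → f w ⋖Ω y → fℓℓ x ≡ y
  dualResidual²-⋖ {f} {fℓ} {fℓℓ} f-mono fℓ-dual fℓℓ-dual {w} {x} {y} w⋖x fw⋖y =
    antisym (proj₂ (fℓℓ-dual x) y x≤fℓy) (⋖∧<⇒≤ fw⋖y fw<fℓℓx)
    where
    x≤fℓy : x ≤Ω fℓ y
    x≤fℓy = ⋖∧<⇒≤ w⋖x (≰⇒> λ fℓy≤w →
      ⋖⇒≱ fw⋖y (≤-trans (proj₁ (fℓ-dual y)) (f-mono fℓy≤w)))

    fw<fℓℓx : f w <Ω fℓℓ x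
    fw<fℓℓx = ≰⇒> λ fℓℓx≤fw →
      ⋖⇒≱ w⋖x (≤-trans (proj₁ (fℓℓ-dual x)) (proj₂ (fℓ-dual (fℓℓ x)) w fℓℓx≤fw))

residual²-⋖ : ∀ Ω → DecidableEquality (Carrier Ω) →
              ∀ {f fr frr} → OrderPreserving Ω f →
              IsResidual Ω f fr → IsResidual Ω fr frr →
              ∀ {v x y} → _⋖_ Ω x v → _⋖_ Ω y (f v) → frr x ≡ y
residual²-⋖ Ω _≟_ f-mono fr-res frr-res x⋖v y⋖fv =
  dualResidual²-⋖ (Ω ᵒᵖ) _≟_ f-mono fr-res frr-res (⋖⇒⋖ᵒᵖ Ω x⋖v) (⋖⇒⋖ᵒᵖ Ω y⋖fv)

lemma2p2 : (Ω : Chain) → IsIntegral Ω → (f : Carrier Ω → Carrier Ω) → OrderPreserving Ω f →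
    (x : Carrier Ω) →
    (∀ (fℓ fℓℓ : Carrier Ω → Carrier Ω) → IsDualResidual Ω f fℓ → IsDualResidual Ω fℓ fℓℓ →
      ∀ (w y : Carrier Ω) → _⋖_ Ω w x → _⋖_ Ω (f w) y → fℓℓ x ≡ y)
    × (∀ (fr frr : Carrier Ω → Carrier Ω) → IsResidual Ω f fr → IsResidual Ω fr frr →
      ∀ (v y : Carrier Ω) → _⋖_ Ω x v → _⋖_ Ω y (f v) → frr x ≡ y)
lemma2p2 Ω integral f f-mono x =
  (λ _ _ fℓ-dual fℓℓ-dual _ _ → dualResidual²-⋖ Ω _≟_ f-mono fℓ-dual fℓℓ-dual) ,
  (λ _ _ fr-res frr-res _ _ → residual²-⋖ Ω _≟_ f-mono fr-res frr-res)
  where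
  _≟_ : DecidableEquality (Carrier Ω)
  _≟_ = integral⇒decEq Ω integral
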